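{- Let $S$ be a numerical semigroup. Then $\rho\ge|C|$.
   Context: A numerical semigroup is a submonoid $S$ of $(\mathbb N,+)$ with $\mathbb N\setminus S$ finite; $S^*=S\setminus\{0\}$, $m=\min S^*$, $c$ is the least $c\in\mathbb N$ with $[c,\infty[\subseteq S$, $q=\lceil c/m\rceil$, and the offset is $\rho=qm-c\in[0,m-1]$. The level function $\lambda:\mathbb N\to\mathbb N$ is given by $\lambda(x)=j$ iff $jm-\rho\le x\le(j+1)m-\rho-1$. $P$ is the set of elements of $S^*$ not expressible as a sum of two elements of $S^*$, $D=S^*\setminus P$. $A=\{x\in S: x-m\notin S\}$ is the Apéry set with respect to $m$, $A^*=A\setminus\{0\}$. An element $s\in S^*$ is compressed if $s=x+y$ for some $x,y\in S^*$ with $\lambda(s)<\lambda(x)+\lambda(y)$. $C$ is the set of compressed elements of $A\cap D$. -}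

module Defs where

open import Data.Nat using (ℕ; zero; suc; _+_; _*_; _∸_; _≤_; _<_)
open import Data.Nat.DivMod using (_/_)
open import Data.Product using (_×_; ∃-syntax)
open import Relation.Nullary using (¬_)
open import Relation.Binary.PropositionalEquality using (_≡_)

record NumericalSemigroup : Set₁ where
  field
    S        : ℕ → Set
    zero∈    : S 0
    +-closed : ∀ {x y} → S x → S y → S (x + y)
    cofinite : ∃[ b ] (∀ n → b ≤ n → S n)

open NumericalSemigroup public

S* : NumericalSemigroup → ℕ → Set
S* NS x = S NS x × 0 < x

IsMultiplicity : NumericalSemigroup → ℕ → Set
IsMultiplicity NS m = S* NS m × (∀ x → S* NS x → m ≤ x)

IsConductor : NumericalSemigroup → ℕ → Set
IsConductor NS c = (∀ n → c ≤ n → S NS n)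
                 × (∀ c' → (∀ n → c' ≤ n → S NS n) → c ≤ c')

-- ceiling division ⌈c/m⌉ (value for m = 0 irrelevant)
⌈_/_⌉ : ℕ → ℕ → ℕ
⌈ c / zero ⌉ = 0
⌈ c / suc k ⌉ = (c + k) / suc k

q : ℕ → ℕ → ℕ
q m c = ⌈ c / m ⌉

ρ : ℕ → ℕ → ℕ
ρ m c = q m c * m ∸ c

-- λ(x) = j  iff  jm - ρ ≤ x ≤ (j+1)m - ρ - 1  (ρ moved across to stay in ℕ)
Level : ℕ → ℕ → ℕ → ℕ → Set
Level m c x j = j * m ≤ x + ρ m c × x + ρ m c < suc j * m

IsP : NumericalSemigroup → ℕ → Set
IsP NS s = S* NS s × ¬ (∃[ x ] ∃[ y ] (S* NS x × S* NS y × s ≡ x + y))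

IsD : NumericalSemigroup → ℕ → Set
IsD NS s = S* NS s × ¬ IsP NS s

-- Apéry set w.r.t. m: x ∈ S with x - m ∉ S (x - m negative counts as ∉ S)
IsApery : NumericalSemigroup → ℕ → ℕ → Set
IsApery NS m x = S NS x × (m ≤ x → ¬ S NS (x ∸ m))

Compressed : NumericalSemigroup → ℕ → ℕ → ℕ → Set
Compressed NS m c s =
  S* NS s × ∃[ x ] ∃[ y ] (S* NS x × S* NS y × s ≡ x + y ×
    ∃[ js ] ∃[ jx ] ∃[ jy ] (Level m c s js × Level m c x jx × Level m c y jy × js < jx + jy))

InC : NumericalSemigroup → ℕ → ℕ → ℕ → Set
InC NS m c s = IsApery NS m s × IsD NS s × Compressed NS m c s

-- Write r(s) = (s + ρ) mod m for the position of s inside its level.  If s = x + y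
-- with λ(s) < λ(x) + λ(y), then (λ(s) + 1) m ≤ (λ(x) + λ(y)) m ≤ s + 2ρ, which
-- forces r(s) ≥ m − ρ: the residues of compressed elements lie in the ρ values
-- m − ρ, …, m − 1.  Distinct Apéry elements have distinct residues modulo m (the
-- larger would otherwise be the smaller plus a multiple of m), so |C| ≤ ρ.
module Submission where

open import Defs
open import Data.Nat using (ℕ; _≤_)
open import Data.List using (List; length)
open import Data.List.Relation.Unary.All using (All; []; _∷_)
open import Data.List.Relation.Unary.Unique.Propositional using (Unique)

open import Data.Nat using (zero; suc; _+_; _*_; _∸_; _<_; s≤s; s≤s⁻¹; z≤n; NonZero)
open import Data.Nat.Properties
open import Data.Nat.DivMod using (_%_; _/_; m≡m%n+[m/n]*n; m%n<n; /-monoˡ-≤; m<n*o⇒m/o<n)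
open import Algebra.Properties.CommutativeSemigroup +-commutativeSemigroup using (xy∙z≈xz∙y; x∙yz≈y∙xz)
open import Data.List using ([]; _∷_; _++_; map; applyUpTo)
open import Data.List.Properties using (length-map; length-applyUpTo; length-++-sucʳ)
open import Data.List.Membership.Propositional using (_∈_)
open import Data.List.Membership.Propositional.Properties using (∈-∃++; ∈-++⁻; ∈-++⁺ˡ; ∈-++⁺ʳ; ∈-applyUpTo⁺)
open import Data.List.Relation.Binary.Subset.Propositional using (_⊆_)
open import Data.List.Relation.Unary.Any using (here; there)
import Data.List.Relation.Unary.All as All
open import Data.List.Relation.Unary.AllPairs using ([]; _∷_)
import Data.List.Relation.Unary.All.Properties as All
open import Data.Product using (_×_; _,_)
open import Data.Sum using (inj₁; inj₂)
open import Data.Empty using (⊥-elim)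
open import Function using (_∘_)
open import Relation.Binary.PropositionalEquality using (_≡_; refl; sym; trans; cong; cong₂; subst; module ≡-Reasoning)

private
  variable
    A B : Set

map⁺-injectiveOn : {P : A → Set} {f : A → B} →
  (∀ {x y} → P x → P y → f x ≡ f y → x ≡ y) →
  ∀ {xs} → All P xs → Unique xs → Unique (map f xs)
map⁺-injectiveOn inj [] [] = []
map⁺-injectiveOn inj (px ∷ pxs) (x∉xs ∷ u) =
  All.map⁺ (All.zipWith (λ (py , x≢y) → x≢y ∘ inj px py) (pxs , x∉xs)) ∷ map⁺-injectiveOn inj pxs u

unique-⊆⇒length≤ : {xs ys : List A} → Unique xs → xs ⊆ ys → length xs ≤ length ys
unique-⊆⇒length≤ {xs = []} _ _ = z≤n
unique-⊆⇒length≤ {xs = x ∷ xs} (x∉xs ∷ u) xs⊆ys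
  with ys₁ , ys₂ , refl ← ∈-∃++ (xs⊆ys (here refl)) = begin
    suc (length xs)            ≤⟨ s≤s (unique-⊆⇒length≤ u xs⊆ys₁ys₂) ⟩
    suc (length (ys₁ ++ ys₂))  ≡⟨ length-++-sucʳ ys₁ x ys₂ ⟨
    length (ys₁ ++ x ∷ ys₂)    ∎
  where
  open ≤-Reasoning
  xs⊆ys₁ys₂ : xs ⊆ ys₁ ++ ys₂
  xs⊆ys₁ys₂ y∈xs with ∈-++⁻ ys₁ (xs⊆ys (there y∈xs))
  ... | inj₁ y∈ys₁          = ∈-++⁺ˡ y∈ys₁
  ... | inj₂ (here refl)    = ⊥-elim (All.lookup x∉xs y∈xs refl)
  ... | inj₂ (there y∈ys₂)  = ∈-++⁺ʳ ys₁ y∈ys₂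

unique-interval⇒length≤ : ∀ {a k xs} → Unique xs → All (λ x → a ≤ x × x < a + k) xs → length xs ≤ k
unique-interval⇒length≤ {a} {k} {xs} u bounds = begin
  length xs                       ≤⟨ unique-⊆⇒length≤ u (All.lookup (All.map ∈interval bounds)) ⟩
  length (applyUpTo (a +_) k)     ≡⟨ length-applyUpTo (a +_) k ⟩
  k                               ∎
  where
  open ≤-Reasoning
  ∈interval : ∀ {x} → a ≤ x × x < a + k → x ∈ applyUpTo (a +_) k
  ∈interval (a≤x , x<a+k) = subst (_∈ applyUpTo (a +_) k) (m+[n∸m]≡n a≤x)
    (∈-applyUpTo⁺ (a +_) (+-cancelˡ-< a _ _ (subst (_< a + k) (sym (m+[n∸m]≡n a≤x)) x<a+k)))

%-≡⇒≡+* : ∀ {x y} m .{{_ : NonZero m}} → x % m ≡ y % m → x ≤ y → y ≡ x + (y / m ∸ x / m) * m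
%-≡⇒≡+* {x} {y} m x%m≡y%m x≤y = begin
  y                                  ≡⟨ m≡m%n+[m/n]*n y m ⟩
  y % m + y / m * m                  ≡⟨ cong₂ (λ r a → r + a * m) x%m≡y%m (m+[n∸m]≡n (/-monoˡ-≤ m x≤y)) ⟨
  x % m + (x / m + d) * m            ≡⟨ cong (x % m +_) (*-distribʳ-+ m (x / m) d) ⟩
  x % m + (x / m * m + d * m)        ≡⟨ +-assoc (x % m) _ _ ⟨
  x % m + x / m * m + d * m          ≡⟨ cong (_+ d * m) (m≡m%n+[m/n]*n x m) ⟨
  x + d * m                          ∎
  where
  open ≡-Reasoning
  d = y / m ∸ x / m

level-excess⇒m≤residue+p : ∀ {m p x y jx jy js} .{{_ : NonZero m}} →
  jx * m ≤ x + p → jy * m ≤ y + p → x + y + p < suc js * m → js < jx + jy →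
  m ≤ (x + y + p) % m + p
level-excess⇒m≤residue+p {m} {p} {x} {y} {jx} {jy} {js} jx≤ jy≤ n<[js+1]m js<jx+jy =
  +-cancelʳ-≤ (a * m) m (r + p) (begin
    m + a * m             ≤⟨ *-monoˡ-≤ m (≤-trans (s≤s a≤js) js<jx+jy) ⟩
    (jx + jy) * m         ≡⟨ *-distribʳ-+ m jx jy ⟩
    jx * m + jy * m       ≤⟨ +-mono-≤ jx≤ jy≤ ⟩
    x + p + (y + p)       ≡⟨ +-assoc (x + p) y p ⟨
    x + p + y + p         ≡⟨ cong (_+ p) (xy∙z≈xz∙y x p y) ⟩
    n + p                 ≡⟨ cong (_+ p) (m≡m%n+[m/n]*n n m) ⟩
    r + a * m + p         ≡⟨ xy∙z≈xz∙y r (a * m) p ⟩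
    r + p + a * m         ∎)
  where
  open ≤-Reasoning
  n = x + y + p
  r = n % m
  a = n / m
  a≤js : a ≤ js
  a≤js = s≤s⁻¹ (m<n*o⇒m/o<n n<[js+1]m)

module _ (NS : NumericalSemigroup) where

  *-closed : ∀ {m} → S NS m → ∀ d → S NS (d * m)
  *-closed m∈S zero    = zero∈ NS
  *-closed m∈S (suc d) = +-closed NS m∈S (*-closed m∈S d)

  apery-minimal : ∀ {m s t} → S NS m → S NS s → IsApery NS m t → ∀ d → t ≡ s + d * m → s ≡ t
  apery-minimal {m} {s} m∈S s∈S _ zero refl = sym (+-identityʳ s)
  apery-minimal {m} {s} m∈S s∈S (_ , t∸m∉S) (suc d) refl =
    ⊥-elim (t∸m∉S (≤-trans (m≤m+n m (d * m)) (m≤n+m _ s)) (subst (S NS) (sym t∸m≡s+dm) s+dm∈S))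
    where
    s+dm∈S : S NS (s + d * m)
    s+dm∈S = +-closed NS s∈S (*-closed m∈S d)
    t∸m≡s+dm : s + (m + d * m) ∸ m ≡ s + d * m
    t∸m≡s+dm = trans (cong (_∸ m) (x∙yz≈y∙xz s m (d * m))) (m+n∸m≡n m (s + d * m))

  apery-residue-≤⇒≡ : ∀ {m s t} k .{{_ : NonZero m}} → S NS m → IsApery NS m s → IsApery NS m t →
    (s + k) % m ≡ (t + k) % m → s ≤ t → s ≡ t
  apery-residue-≤⇒≡ {m} {s} {t} k m∈S (s∈S , _) t∈A ≡mod s≤t = apery-minimal m∈S s∈S t∈A d
    (+-cancelʳ-≡ k _ _ (trans (%-≡⇒≡+* m ≡mod (+-monoˡ-≤ k s≤t)) (xy∙z≈xz∙y s k (d * m))))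
    where
    d = (t + k) / m ∸ (s + k) / m

  apery-residue-injective : ∀ {m s t} k .{{_ : NonZero m}} → S NS m → IsApery NS m s → IsApery NS m t →
    (s + k) % m ≡ (t + k) % m → s ≡ t
  apery-residue-injective {s = s} {t} k m∈S s∈A t∈A ≡mod with ≤-total s t
  ... | inj₁ s≤t = apery-residue-≤⇒≡ k m∈S s∈A t∈A ≡mod s≤t
  ... | inj₂ t≤s = sym (apery-residue-≤⇒≡ k m∈S t∈A s∈A (sym ≡mod) t≤s)

  compressed⇒m∸ρ≤residue : ∀ {m c s} .{{_ : NonZero m}} → Compressed NS m c s → m ∸ ρ m c ≤ (s + ρ m c) % m
  compressed⇒m∸ρ≤residue {m} {c}
    (_ , _ , _ , _ , _ , refl , _ , jx , jy , (_ , s<) , (jx≤ , _) , (jy≤ , _) , js<jx+jy) =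
    m≤n+o⇒m∸n≤o m (ρ m c) (subst (m ≤_) (+-comm _ (ρ m c))
      (level-excess⇒m≤residue+p {jx = jx} {jy} jx≤ jy≤ s< js<jx+jy))

proposition2p18 : (NS : NumericalSemigroup) (m c : ℕ) →
    IsMultiplicity NS m → IsConductor NS c →
    (l : List ℕ) → Unique l → All (InC NS m c) l → length l ≤ ρ m c
proposition2p18 NS zero c ((_ , ()) , _) _ l u l⊆C
proposition2p18 NS m@(suc _) c ((m∈S , _) , _) _ l u l⊆C = begin
  length l                 ≡⟨ length-map residue l ⟨
  length (map residue l)   ≤⟨ unique-interval⇒length≤
                                (map⁺-injectiveOn residue-injective l⊆C u)
                                (All.map⁺ (All.map residue-bounds l⊆C)) ⟩
  ρ m c                    ∎
  where
  open ≤-Reasoning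
  residue : ℕ → ℕ
  residue s = (s + ρ m c) % m
  residue-injective : ∀ {s t} → InC NS m c s → InC NS m c t → residue s ≡ residue t → s ≡ t
  residue-injective (s∈A , _) (t∈A , _) = apery-residue-injective NS (ρ m c) m∈S s∈A t∈A
  residue-bounds : ∀ {s} → InC NS m c s → m ∸ ρ m c ≤ residue s × residue s < m ∸ ρ m c + ρ m c
  residue-bounds {s} (_ , _ , s-compressed) =
    compressed⇒m∸ρ≤residue NS {c = c} s-compressed ,
    <-≤-trans (m%n<n (s + ρ m c) m) (subst (m ≤_) (+-comm (ρ m c) _) (m≤n+m∸n m (ρ m c)))
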